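{- The set-pair function $g:\mathcal{P}_2(V)\to[0,+\infty)$, $g(A,B)=\sqrt{|A|+|B|}$, is strictly submodular.
   Context: $V=\{1,\ldots,n\}$, $\mathcal{P}_2(V)=\{(A,B):A,B\subset V,\ A\cap B=\varnothing\}$. Write $(A,B)\subset(C,D)$ if $A\subset C$ and $B\subset D$. A function $g:\mathcal{P}_2(V)\to[0,+\infty)$ is strictly submodular if for all $(A,B),(C,D)\in\mathcal{P}_2(V)$: $g(A,B)+g(C,D)\ge g((A\cup C)\setminus(B\cup D),(B\cup D)\setminus(A\cup C))+g(A\cap C,B\cap D)$, with equality if and only if $(A,B)\subset(C,D)$ or $(C,D)\subset(A,B)$. -}

module Defs where

open import Level using (Level; _⊔_) renaming (suc to lsuc)
open import Data.Nat using (ℕ; zero; suc) renaming (_+_ to _+ℕ_)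
open import Data.Product using (Σ; _×_; _,_; proj₁; proj₂; ∃)
open import Data.Sum using (_⊎_)
open import Data.Fin.Subset using (Subset; _⊆_; _∩_; _∪_; _─_; ∣_∣; Empty)
open import Algebra.Bundles using (CommutativeRing)
open import Relation.Binary.Structures using (IsTotalOrder)
open import Relation.Nullary using (¬_)
open import Function.Bundles using (_⇔_)

-- The real numbers (with the usual √) form such a structure; the
-- agda-stdlib has no reals, so the statement is made for every such field.
record OrderedFieldWithSqrt (c ℓ : Level) : Set (lsuc (c ⊔ ℓ)) where
  field
    commutativeRing : CommutativeRing c ℓ
  open CommutativeRing commutativeRing public
  field
    _≤_          : Carrier → Carrier → Set ℓ
    isTotalOrder : IsTotalOrder _≈_ _≤_
    +-monoˡ-≤    : ∀ {x y} z → x ≤ y → (x + z) ≤ (y + z)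
    *-nonneg     : ∀ {x y} → 0# ≤ x → 0# ≤ y → 0# ≤ (x * y)
    0≉1          : ¬ (0# ≈ 1#)
    inverse      : ∀ x → ¬ (x ≈ 0#) → ∃ λ y → (x * y) ≈ 1#
    sqrt         : Carrier → Carrier
    sqrt-nonneg  : ∀ x → 0# ≤ sqrt x
    sqrt-square  : ∀ x → 0# ≤ x → (sqrt x * sqrt x) ≈ x

  fromℕ : ℕ → Carrier
  fromℕ zero    = 0#
  fromℕ (suc k) = 1# + fromℕ k

-- 𝒫₂(V) for V = Fin n : pairs of disjoint subsets
P₂ : ℕ → Set
P₂ n = Σ (Subset n × Subset n) λ p → Empty (proj₁ p ∩ proj₂ p)

_⊑_ : ∀ {n} → P₂ n → P₂ n → Set
((A , B) , _) ⊑ ((C , D) , _) = (A ⊆ C) × (B ⊆ D)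

joinFst joinSnd meetFst meetSnd : ∀ {n} → P₂ n → P₂ n → Subset n
joinFst ((A , B) , _) ((C , D) , _) = (A ∪ C) ─ (B ∪ D)
joinSnd ((A , B) , _) ((C , D) , _) = (B ∪ D) ─ (A ∪ C)
meetFst ((A , B) , _) ((C , D) , _) = A ∩ C
meetSnd ((A , B) , _) ((C , D) , _) = B ∩ D

module _ {c ℓ} (F : OrderedFieldWithSqrt c ℓ) where
  open OrderedFieldWithSqrt F

  -- strict submodularity of g : 𝒫₂(V) → [0,+∞), values in F.
  -- The arguments of g on the right are plain subset pairs; g is given on
  -- all pairs of subsets but only pairs in 𝒫₂ are ever used (the join and
  -- meet pairs are disjoint).
  StrictlySubmodular : (n : ℕ) → (Subset n → Subset n → Carrier) → Set ℓ
  StrictlySubmodular n g =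
    (∀ (p : P₂ n) → 0# ≤ g (proj₁ (proj₁ p)) (proj₂ (proj₁ p)))
    × (∀ (p q : P₂ n) →
         let lhs = g (proj₁ (proj₁ p)) (proj₂ (proj₁ p)) + g (proj₁ (proj₁ q)) (proj₂ (proj₁ q))
             rhs = g (joinFst p q) (joinSnd p q) + g (meetFst p q) (meetSnd p q)
         in (rhs ≤ lhs) × ((lhs ≈ rhs) ⇔ ((p ⊑ q) ⊎ (q ⊑ p))))

  gSqrt : (n : ℕ) → Subset n → Subset n → Carrier
  gSqrt n A B = sqrt (fromℕ (∣ A ∣ +ℕ ∣ B ∣))

module Submission where

-- Write a = |A| + |B| and c = |C| + |D|, and j, m for the sizes of the join and the meet
-- pair. Counting element by element gives j + m ≤ a + c, m ≤ a and m ≤ c; hence also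
-- jm ≤ ac, and comparing squares yields √j + √m ≤ √a + √c. Equality of the square roots
-- forces j + m = a + c and jm = ac, so m = a or m = c; and m = a means exactly that
-- A ⊆ C and B ⊆ D (symmetrically for m = c).

open import Level using (Level)
open import Data.Nat using (ℕ)
open import Data.Product using (_,_)
open import Data.Sum using (_⊎_; inj₁; inj₂) renaming (map to ⊎-map)
open import Function.Bundles using (mk⇔)
open import Defs

module NatArithmetic where

  open import Data.Nat using (_+_; _*_; _≤_)
  open import Data.Nat.Properties
  open import Data.Nat.Solver using (module +-*-Solver)
  open import Data.Product using (_×_)
  open import Relation.Binary.PropositionalEquality using (_≡_; refl; sym; trans; cong; subst; module ≡-Reasoning)

  private
    product-expansion : ∀ m x y → (m + x) * (m + y) ≡ (m + x + y) * m + x * y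
    product-expansion = solve 3 (λ m x y → (m :+ x) :* (m :+ y) := (m :+ x :+ y) :* m :+ x :* y) refl
      where open +-*-Solver

    sum-expansion : ∀ m x y → (m + x) + (m + y) ≡ (m + x + y) + m
    sum-expansion = solve 3 (λ m x y → (m :+ x) :+ (m :+ y) := (m :+ x :+ y) :+ m) refl
      where open +-*-Solver

  j+m≤a+c⇒j*m≤a*c : ∀ {j m a c} → j + m ≤ a + c → m ≤ a → m ≤ c → j * m ≤ a * c
  j+m≤a+c⇒j*m≤a*c {j} {m} j+m≤a+c m≤a m≤c with m≤n⇒∃[o]m+o≡n m≤a | m≤n⇒∃[o]m+o≡n m≤c
  ... | x , refl | y , refl = begin
    j * m                   ≤⟨ *-monoˡ-≤ m j≤m+x+y ⟩
    (m + x + y) * m         ≤⟨ m≤m+n _ (x * y) ⟩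
    (m + x + y) * m + x * y ≡⟨ product-expansion m x y ⟨
    (m + x) * (m + y)       ∎
    where
    open ≤-Reasoning
    j≤m+x+y : j ≤ m + x + y
    j≤m+x+y = +-cancelʳ-≤ m j (m + x + y) (subst (j + m ≤_) (sum-expansion m x y) j+m≤a+c)

  j+m≡a+c∧j*m≡a*c⇒m≡a∨m≡c : ∀ {j m a c} → j + m ≡ a + c → j * m ≡ a * c → m ≤ a → m ≤ c → m ≡ a ⊎ m ≡ c
  j+m≡a+c∧j*m≡a*c⇒m≡a∨m≡c {j} {m} j+m≡a+c j*m≡a*c m≤a m≤c with m≤n⇒∃[o]m+o≡n m≤a | m≤n⇒∃[o]m+o≡n m≤c
  ... | x , refl | y , refl = ⊎-map m≡m+0 m≡m+0 (m*n≡0⇒m≡0∨n≡0 x xy≡0)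
    where
    m≡m+0 : ∀ {z} → z ≡ 0 → m ≡ m + z
    m≡m+0 refl = sym (+-identityʳ m)
    j≡m+x+y : j ≡ m + x + y
    j≡m+x+y = +-cancelʳ-≡ m j (m + x + y) (trans j+m≡a+c (sum-expansion m x y))
    xy≡0 : x * y ≡ 0
    xy≡0 = +-cancelˡ-≡ ((m + x + y) * m) (x * y) 0 (begin
      (m + x + y) * m + x * y ≡⟨ product-expansion m x y ⟨
      (m + x) * (m + y)       ≡⟨ j*m≡a*c ⟨
      j * m                   ≡⟨ cong (_* m) j≡m+x+y ⟩
      (m + x + y) * m         ≡⟨ +-identityʳ _ ⟨
      (m + x + y) * m + 0     ∎)
      where open ≡-Reasoning

  +-≡-split : ∀ {x y u v} → x ≤ u → y ≤ v → x + y ≡ u + v → x ≡ u × y ≡ v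
  +-≡-split {x} {y} {u} {v} x≤u y≤v e = x≡u , +-cancelˡ-≡ u y v (subst (λ z → z + y ≡ u + v) x≡u e)
    where
    x≡u : x ≡ u
    x≡u = ≤-antisym x≤u (+-cancelʳ-≤ y u x (subst (u + y ≤_) (sym e) (+-monoʳ-≤ u y≤v)))


module SetPairSizes where

  open import Data.Nat using (suc; _+_; _≤_)
  open import Data.Nat.Properties
  open import Data.Sum using ([_,_])
  open import Data.Fin.Subset using (Subset; inside; outside; _⊆_; _∩_; _∪_; _─_; ∣_∣; Empty)
  open import Data.Fin.Subset.Properties
  open import Data.Vec using ([]; _∷_)
  open import Function using (id)
  open import Relation.Binary.PropositionalEquality using (_≡_; refl; sym; trans; cong; cong₂; subst)
  open import Relation.Nullary using (contradiction)
  open import Algebra.Properties.CommutativeSemigroup +-commutativeSemigroup using ()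
    renaming (interchange to +-interchange)
  open NatArithmetic using (+-≡-split)

  ∣p∪q∣+∣p∩q∣≡∣p∣+∣q∣ : ∀ {n} (p q : Subset n) → ∣ p ∪ q ∣ + ∣ p ∩ q ∣ ≡ ∣ p ∣ + ∣ q ∣
  ∣p∪q∣+∣p∩q∣≡∣p∣+∣q∣ []            []            = refl
  ∣p∪q∣+∣p∩q∣≡∣p∣+∣q∣ (inside  ∷ p) (inside  ∷ q) =
    cong suc (trans (+-suc _ _) (trans (cong suc (∣p∪q∣+∣p∩q∣≡∣p∣+∣q∣ p q)) (sym (+-suc _ _))))
  ∣p∪q∣+∣p∩q∣≡∣p∣+∣q∣ (inside  ∷ p) (outside ∷ q) = cong suc (∣p∪q∣+∣p∩q∣≡∣p∣+∣q∣ p q)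
  ∣p∪q∣+∣p∩q∣≡∣p∣+∣q∣ (outside ∷ p) (inside  ∷ q) =
    trans (cong suc (∣p∪q∣+∣p∩q∣≡∣p∣+∣q∣ p q)) (sym (+-suc _ _))
  ∣p∪q∣+∣p∩q∣≡∣p∣+∣q∣ (outside ∷ p) (outside ∷ q) = ∣p∪q∣+∣p∩q∣≡∣p∣+∣q∣ p q

  ∣p∩q∣≡∣p∣⇒p⊆q : ∀ {n} (p q : Subset n) → ∣ p ∩ q ∣ ≡ ∣ p ∣ → p ⊆ q
  ∣p∩q∣≡∣p∣⇒p⊆q []            []            _ = id
  ∣p∩q∣≡∣p∣⇒p⊆q (inside  ∷ p) (inside  ∷ q) e = in⊆in (∣p∩q∣≡∣p∣⇒p⊆q p q (suc-injective e))
  ∣p∩q∣≡∣p∣⇒p⊆q (inside  ∷ p) (outside ∷ q) e = contradiction (subst (_≤ ∣ p ∣) e (∣p∩q∣≤∣p∣ p q)) 1+n≰n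
  ∣p∩q∣≡∣p∣⇒p⊆q (outside ∷ p) (_       ∷ q) e = out⊆ (∣p∩q∣≡∣p∣⇒p⊆q p q e)

  p⊆q⇒p∩q≡p : ∀ {n} {p q : Subset n} → p ⊆ q → p ∩ q ≡ p
  p⊆q⇒p∩q≡p {p = p} {q} p⊆q = ⊆-antisym (p∩q⊆p p q) (λ x∈p → x∈p∩q⁺ (x∈p , p⊆q x∈p))

  p⊆q⇒p∪q≡q : ∀ {n} {p q : Subset n} → p ⊆ q → p ∪ q ≡ q
  p⊆q⇒p∪q≡q {p = p} {q} p⊆q = ⊆-antisym (λ x∈p∪q → [ p⊆q , id ] (x∈p∪q⁻ p q x∈p∪q)) (q⊆p∪q p q)

  Empty[p∩q]⇒p─q≡p : ∀ {n} {p q : Subset n} → Empty (p ∩ q) → p ─ q ≡ p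
  Empty[p∩q]⇒p─q≡p {p = p} {q} disjoint = ⊆-antisym (p─q⊆p p q)
    (λ x∈p → x∈p∧x∉q⇒x∈p─q x∈p (λ x∈q → disjoint (_ , x∈p∩q⁺ (x∈p , x∈q))))

  size : ∀ {n} → P₂ n → ℕ
  size ((A , B) , _) = ∣ A ∣ + ∣ B ∣

  joinSize meetSize : ∀ {n} → P₂ n → P₂ n → ℕ
  joinSize p q = ∣ joinFst p q ∣ + ∣ joinSnd p q ∣
  meetSize p q = ∣ meetFst p q ∣ + ∣ meetSnd p q ∣

  joinSize+meetSize≤size+size : ∀ {n} (p q : P₂ n) → joinSize p q + meetSize p q ≤ size p + size q
  joinSize+meetSize≤size+size ((A , B) , _) ((C , D) , _) = begin
    joinSize′ + (∣ A ∩ C ∣ + ∣ B ∩ D ∣)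
      ≤⟨ +-monoˡ-≤ _ (+-mono-≤ (∣p─q∣≤∣p∣ (A ∪ C) (B ∪ D)) (∣p─q∣≤∣p∣ (B ∪ D) (A ∪ C))) ⟩
    (∣ A ∪ C ∣ + ∣ B ∪ D ∣) + (∣ A ∩ C ∣ + ∣ B ∩ D ∣)
      ≡⟨ +-interchange (∣ A ∪ C ∣) (∣ B ∪ D ∣) (∣ A ∩ C ∣) (∣ B ∩ D ∣) ⟩
    (∣ A ∪ C ∣ + ∣ A ∩ C ∣) + (∣ B ∪ D ∣ + ∣ B ∩ D ∣)
      ≡⟨ cong₂ _+_ (∣p∪q∣+∣p∩q∣≡∣p∣+∣q∣ A C) (∣p∪q∣+∣p∩q∣≡∣p∣+∣q∣ B D) ⟩
    (∣ A ∣ + ∣ C ∣) + (∣ B ∣ + ∣ D ∣)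
      ≡⟨ +-interchange (∣ A ∣) (∣ C ∣) (∣ B ∣) (∣ D ∣) ⟩
    (∣ A ∣ + ∣ B ∣) + (∣ C ∣ + ∣ D ∣)
      ∎
    where
    open ≤-Reasoning
    joinSize′ : ℕ
    joinSize′ = ∣ (A ∪ C) ─ (B ∪ D) ∣ + ∣ (B ∪ D) ─ (A ∪ C) ∣

  meetSize≤sizeˡ : ∀ {n} (p q : P₂ n) → meetSize p q ≤ size p
  meetSize≤sizeˡ ((A , B) , _) ((C , D) , _) = +-mono-≤ (∣p∩q∣≤∣p∣ A C) (∣p∩q∣≤∣p∣ B D)

  meetSize≤sizeʳ : ∀ {n} (p q : P₂ n) → meetSize p q ≤ size q
  meetSize≤sizeʳ ((A , B) , _) ((C , D) , _) = +-mono-≤ (∣p∩q∣≤∣q∣ A C) (∣p∩q∣≤∣q∣ B D)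

  joinSize-comm : ∀ {n} (p q : P₂ n) → joinSize p q ≡ joinSize q p
  joinSize-comm ((A , B) , _) ((C , D) , _) =
    cong₂ (λ X Y → ∣ X ─ Y ∣ + ∣ Y ─ X ∣) (∪-comm A C) (∪-comm B D)

  meetSize-comm : ∀ {n} (p q : P₂ n) → meetSize p q ≡ meetSize q p
  meetSize-comm ((A , B) , _) ((C , D) , _) = cong₂ (λ X Y → ∣ X ∣ + ∣ Y ∣) (∩-comm A C) (∩-comm B D)

  meetSize≡sizeˡ⇒⊑ : ∀ {n} (p q : P₂ n) → meetSize p q ≡ size p → p ⊑ q
  meetSize≡sizeˡ⇒⊑ ((A , B) , _) ((C , D) , _) e with +-≡-split (∣p∩q∣≤∣p∣ A C) (∣p∩q∣≤∣p∣ B D) e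
  ... | ∣A∩C∣≡∣A∣ , ∣B∩D∣≡∣B∣ = ∣p∩q∣≡∣p∣⇒p⊆q A C ∣A∩C∣≡∣A∣ , ∣p∩q∣≡∣p∣⇒p⊆q B D ∣B∩D∣≡∣B∣

  meetSize≡sizeʳ⇒⊒ : ∀ {n} (p q : P₂ n) → meetSize p q ≡ size q → q ⊑ p
  meetSize≡sizeʳ⇒⊒ p q e = meetSize≡sizeˡ⇒⊑ q p (trans (meetSize-comm q p) e)

  ⊑⇒meetSize≡size : ∀ {n} (p q : P₂ n) → p ⊑ q → meetSize p q ≡ size p
  ⊑⇒meetSize≡size p q (A⊆C , B⊆D) = cong₂ _+_ (cong ∣_∣ (p⊆q⇒p∩q≡p A⊆C)) (cong ∣_∣ (p⊆q⇒p∩q≡p B⊆D))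

  ⊑⇒joinSize≡size : ∀ {n} (p q : P₂ n) → p ⊑ q → joinSize p q ≡ size q
  ⊑⇒joinSize≡size ((A , B) , _) ((C , D) , C∩D=∅) (A⊆C , B⊆D) =
    cong₂ (λ X Y → ∣ X ∣ + ∣ Y ∣) (join-side A⊆C B⊆D C∩D=∅) (join-side B⊆D A⊆C (subst Empty (∩-comm C D) C∩D=∅))
    where
    join-side : ∀ {n} {X Y Z W : Subset n} → X ⊆ Z → Y ⊆ W → Empty (Z ∩ W) → (X ∪ Z) ─ (Y ∪ W) ≡ Z
    join-side X⊆Z Y⊆W Z∩W=∅ =
      trans (cong₂ _─_ (p⊆q⇒p∪q≡q X⊆Z) (p⊆q⇒p∪q≡q Y⊆W)) (Empty[p∩q]⇒p─q≡p Z∩W=∅)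


module OrderedFieldProperties {c ℓ} (F : OrderedFieldWithSqrt c ℓ) where

  open import Data.Nat using (zero; suc) renaming (_+_ to _+ℕ_; _*_ to _*ℕ_; _≤_ to _≤ℕ_)
  import Data.Nat.Properties as ℕ
  open import Data.Product using (_×_; proj₁; proj₂)
  open import Relation.Nullary using (¬_; contradiction)
  open import Relation.Binary.Bundles using (Poset)
  open import Relation.Binary.Structures using (IsTotalOrder)
  import Relation.Binary.PropositionalEquality as ≡
  import Algebra.Properties.Group as GroupProperties
  import Algebra.Properties.Ring as RingProperties
  import Algebra.Solver.Ring.NaturalCoefficients.Default as Solver
  import Relation.Binary.Reasoning.PartialOrder as PosetReasoning
  open NatArithmetic using (j+m≤a+c⇒j*m≤a*c; j+m≡a+c∧j*m≡a*c⇒m≡a∨m≡c)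

  open OrderedFieldWithSqrt F hiding (_≤_)

  -- The record field _≤_ has the default fixity, binding tighter than _+_.
  infix 4 _≤_
  _≤_ : Carrier → Carrier → Set ℓ
  _≤_ = OrderedFieldWithSqrt._≤_ F

  open IsTotalOrder isTotalOrder using (isPartialOrder; total; antisym)
    renaming (refl to ≤-refl; reflexive to ≤-reflexive; trans to ≤-trans)
  open GroupProperties +-group using (∙-cancelˡ; //-rightDividesˡ; //-rightDividesʳ; ⁻¹-involutive)
  open RingProperties ring using (-1*x≈-x)
  open Solver commutativeSemiring using (solve; _:+_; _:*_; _:=_)

  poset : Poset c ℓ ℓ
  poset = record { isPartialOrder = isPartialOrder }

  open PosetReasoning poset

  +-monoʳ-≤ : ∀ {x y} z → x ≤ y → z + x ≤ z + y
  +-monoʳ-≤ {x} {y} z x≤y = begin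
    z + x  ≈⟨ +-comm z x ⟩
    x + z  ≤⟨ +-monoˡ-≤ z x≤y ⟩
    y + z  ≈⟨ +-comm y z ⟩
    z + y  ∎

  +-mono-≤ : ∀ {x x′ y y′} → x ≤ x′ → y ≤ y′ → x + y ≤ x′ + y′
  +-mono-≤ {x′ = x′} {y = y} x≤x′ y≤y′ = ≤-trans (+-monoˡ-≤ y x≤x′) (+-monoʳ-≤ x′ y≤y′)

  +-cancelʳ-≤ : ∀ {x y} z → x + z ≤ y + z → x ≤ y
  +-cancelʳ-≤ {x} {y} z x+z≤y+z = begin
    x          ≈⟨ //-rightDividesʳ z x ⟨
    x + z - z  ≤⟨ +-monoˡ-≤ (- z) x+z≤y+z ⟩
    y + z - z  ≈⟨ //-rightDividesʳ z y ⟩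
    y          ∎

  +-nonNeg : ∀ {x y} → 0# ≤ x → 0# ≤ y → 0# ≤ x + y
  +-nonNeg 0≤x 0≤y = ≤-trans (≤-reflexive (sym (+-identityʳ 0#))) (+-mono-≤ 0≤x 0≤y)

  x≤y⇒0≤y-x : ∀ {x y} → x ≤ y → 0# ≤ y - x
  x≤y⇒0≤y-x {x} {y} x≤y = begin
    0#     ≈⟨ -‿inverseʳ x ⟨
    x - x  ≤⟨ +-monoˡ-≤ (- x) x≤y ⟩
    y - x  ∎

  +-≈-split : ∀ {x y u v} → x ≤ u → y ≤ v → x + y ≈ u + v → x ≈ u × y ≈ v
  +-≈-split {x} {y} {u} {v} x≤u y≤v e = x≈u , ∙-cancelˡ u y v (trans (+-congʳ (sym x≈u)) e)
    where
    x≈u : x ≈ u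
    x≈u = antisym x≤u (+-cancelʳ-≤ y (begin
      u + y  ≤⟨ +-monoʳ-≤ u y≤v ⟩
      u + v  ≈⟨ e ⟨
      x + y  ∎))

  *-monoˡ-≤-nonNeg : ∀ {x y z} → 0# ≤ z → x ≤ y → x * z ≤ y * z
  *-monoˡ-≤-nonNeg {x} {y} {z} 0≤z x≤y = begin
    x * z                ≈⟨ +-identityˡ (x * z) ⟨
    0# + x * z           ≤⟨ +-monoˡ-≤ (x * z) (*-nonneg (x≤y⇒0≤y-x x≤y) 0≤z) ⟩
    (y - x) * z + x * z  ≈⟨ distribʳ z (y - x) x ⟨
    (y - x + x) * z      ≈⟨ *-congʳ (//-rightDividesˡ x y) ⟩
    y * z                ∎

  *-monoʳ-≤-nonNeg : ∀ {x y z} → 0# ≤ z → x ≤ y → z * x ≤ z * y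
  *-monoʳ-≤-nonNeg {x} {y} {z} 0≤z x≤y = begin
    z * x  ≈⟨ *-comm z x ⟩
    x * z  ≤⟨ *-monoˡ-≤-nonNeg 0≤z x≤y ⟩
    y * z  ≈⟨ *-comm y z ⟩
    z * y  ∎

  *-cancelʳ-≉0 : ∀ {x y z} → ¬ z ≈ 0# → x * z ≈ y * z → x ≈ y
  *-cancelʳ-≉0 {x} {y} {z} z≉0 xz≈yz with inverse z z≉0
  ... | z⁻¹ , zz⁻¹≈1 = begin-equality
    x              ≈⟨ *-identityʳ x ⟨
    x * 1#         ≈⟨ *-congˡ zz⁻¹≈1 ⟨
    x * (z * z⁻¹)  ≈⟨ *-assoc x z z⁻¹ ⟨
    x * z * z⁻¹    ≈⟨ *-congʳ xz≈yz ⟩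
    y * z * z⁻¹    ≈⟨ *-assoc y z z⁻¹ ⟩
    y * (z * z⁻¹)  ≈⟨ *-congˡ zz⁻¹≈1 ⟩
    y * 1#         ≈⟨ *-identityʳ y ⟩
    y              ∎

  square-≤⇒≤ : ∀ {x y} → 0# ≤ x → 0# ≤ y → ¬ y ≈ 0# → x * x ≤ y * y → x ≤ y
  square-≤⇒≤ {x} {y} 0≤x 0≤y y≉0 xx≤yy with total x y
  ... | inj₁ x≤y = x≤y
  ... | inj₂ y≤x = ≤-reflexive (*-cancelʳ-≉0 y≉0 (antisym xy≤yy yy≤xy))
    where
    xy≤yy : x * y ≤ y * y
    xy≤yy = ≤-trans (*-monoʳ-≤-nonNeg 0≤x y≤x) xx≤yy
    yy≤xy : y * y ≤ x * y
    yy≤xy = *-monoˡ-≤-nonNeg 0≤y y≤x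

  nonNeg-+-≉0 : ∀ {x y} → 0# ≤ x → 0# ≤ y → ¬ x ≈ 0# → ¬ x + y ≈ 0#
  nonNeg-+-≉0 {x} {y} 0≤x 0≤y x≉0 x+y≈0 = x≉0 (antisym x≤0 0≤x)
    where
    x≤0 : x ≤ 0#
    x≤0 = begin
      x       ≈⟨ +-identityʳ x ⟨
      x + 0#  ≤⟨ +-monoʳ-≤ x 0≤y ⟩
      x + y   ≈⟨ x+y≈0 ⟩
      0#      ∎

  0≤1 : 0# ≤ 1#
  0≤1 with total 0# 1#
  ... | inj₁ 0≤1 = 0≤1
  ... | inj₂ 1≤0 = begin
    0#            ≤⟨ *-nonneg 0≤-1 0≤-1 ⟩
    - 1# * - 1#   ≈⟨ -1*x≈-x (- 1#) ⟩
    - - 1#        ≈⟨ ⁻¹-involutive 1# ⟩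
    1#            ∎
    where
    0≤-1 : 0# ≤ - 1#
    0≤-1 = ≤-trans (x≤y⇒0≤y-x 1≤0) (≤-reflexive (+-identityˡ (- 1#)))

  fromℕ-nonNeg : ∀ k → 0# ≤ fromℕ k
  fromℕ-nonNeg zero    = ≤-refl
  fromℕ-nonNeg (suc k) = +-nonNeg 0≤1 (fromℕ-nonNeg k)

  fromℕ-+ : ∀ u v → fromℕ (u +ℕ v) ≈ fromℕ u + fromℕ v
  fromℕ-+ zero    v = sym (+-identityˡ (fromℕ v))
  fromℕ-+ (suc u) v = trans (+-congˡ (fromℕ-+ u v)) (sym (+-assoc 1# (fromℕ u) (fromℕ v)))

  fromℕ-* : ∀ u v → fromℕ (u *ℕ v) ≈ fromℕ u * fromℕ v
  fromℕ-* zero    v = sym (zeroˡ (fromℕ v))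
  fromℕ-* (suc u) v = begin-equality
    fromℕ (v +ℕ u *ℕ v)                ≈⟨ fromℕ-+ v (u *ℕ v) ⟩
    fromℕ v + fromℕ (u *ℕ v)           ≈⟨ +-cong (sym (*-identityˡ (fromℕ v))) (fromℕ-* u v) ⟩
    1# * fromℕ v + fromℕ u * fromℕ v   ≈⟨ distribʳ (fromℕ v) 1# (fromℕ u) ⟨
    (1# + fromℕ u) * fromℕ v           ∎

  fromℕ-mono-≤ : ∀ {u v} → u ≤ℕ v → fromℕ u ≤ fromℕ v
  fromℕ-mono-≤ {u} u≤v with ℕ.m≤n⇒∃[o]m+o≡n u≤v
  ... | k , ≡.refl = begin
    fromℕ u             ≈⟨ +-identityʳ (fromℕ u) ⟨
    fromℕ u + 0#        ≤⟨ +-monoʳ-≤ (fromℕ u) (fromℕ-nonNeg k) ⟩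
    fromℕ u + fromℕ k   ≈⟨ fromℕ-+ u k ⟨
    fromℕ (u +ℕ k)      ∎

  fromℕ-suc≉0 : ∀ k → ¬ fromℕ (suc k) ≈ 0#
  fromℕ-suc≉0 k 1+k≈0 = 0≉1 (antisym 0≤1 (begin
    1#             ≈⟨ +-identityʳ 1# ⟨
    1# + 0#        ≤⟨ +-monoʳ-≤ 1# (fromℕ-nonNeg k) ⟩
    1# + fromℕ k   ≈⟨ 1+k≈0 ⟩
    0#             ∎))

  fromℕ-injective : ∀ u v → fromℕ u ≈ fromℕ v → u ≡.≡ v
  fromℕ-injective zero    zero    _ = ≡.refl
  fromℕ-injective zero    (suc v) e = contradiction (sym e) (fromℕ-suc≉0 v)
  fromℕ-injective (suc u) zero    e = contradiction e (fromℕ-suc≉0 u)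
  fromℕ-injective (suc u) (suc v) e = ≡.cong suc (fromℕ-injective u v (∙-cancelˡ 1# _ _ e))

  square≈fromℕ-suc⇒≉0 : ∀ {x} k → x * x ≈ fromℕ (suc k) → ¬ x ≈ 0#
  square≈fromℕ-suc⇒≉0 {x} k xx≈1+k x≈0 = fromℕ-suc≉0 k (begin-equality
    fromℕ (suc k)  ≈⟨ xx≈1+k ⟨
    x * x          ≈⟨ *-cong x≈0 x≈0 ⟩
    0# * 0#        ≈⟨ zeroˡ 0# ⟩
    0#             ∎)

  square≈fromℕ-mono : ∀ {x y u v} → 0# ≤ x → 0# ≤ y →
    x * x ≈ fromℕ u → y * y ≈ fromℕ (suc v) → u ≤ℕ suc v → x ≤ y
  square≈fromℕ-mono {x} {y} {u} {v} 0≤x 0≤y xx≈u yy≈1+v u≤1+v =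
    square-≤⇒≤ 0≤x 0≤y (square≈fromℕ-suc⇒≉0 v yy≈1+v) (begin
      x * x          ≈⟨ xx≈u ⟩
      fromℕ u        ≤⟨ fromℕ-mono-≤ u≤1+v ⟩
      fromℕ (suc v)  ≈⟨ yy≈1+v ⟨
      y * y          ∎)

  √ℕ : ℕ → Carrier
  √ℕ k = sqrt (fromℕ k)

  √ℕ-nonNeg : ∀ k → 0# ≤ √ℕ k
  √ℕ-nonNeg k = sqrt-nonneg (fromℕ k)

  √ℕ-square : ∀ k → √ℕ k * √ℕ k ≈ fromℕ k
  √ℕ-square k = sqrt-square (fromℕ k) (fromℕ-nonNeg k)

  √ℕ-suc≉0 : ∀ k → ¬ √ℕ (suc k) ≈ 0#
  √ℕ-suc≉0 k = square≈fromℕ-suc⇒≉0 k (√ℕ-square (suc k))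

  √ℕ-mono-≤ : ∀ {u v} → u ≤ℕ v → √ℕ u ≤ √ℕ v
  √ℕ-mono-≤ {v = zero}  u≤0   with ≡.refl ← ℕ.n≤0⇒n≡0 u≤0 = ≤-refl
  √ℕ-mono-≤ {u} {suc v} u≤1+v =
    square≈fromℕ-mono (√ℕ-nonNeg u) (√ℕ-nonNeg (suc v)) (√ℕ-square u) (√ℕ-square (suc v)) u≤1+v

  √ℕ-*-square : ∀ u v → (√ℕ u * √ℕ v) * (√ℕ u * √ℕ v) ≈ fromℕ (u *ℕ v)
  √ℕ-*-square u v = begin-equality
    (√ℕ u * √ℕ v) * (√ℕ u * √ℕ v)  ≈⟨ solve 2 (λ x y → (x :* y) :* (x :* y) := (x :* x) :* (y :* y)) refl (√ℕ u) (√ℕ v) ⟩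
    (√ℕ u * √ℕ u) * (√ℕ v * √ℕ v)  ≈⟨ *-cong (√ℕ-square u) (√ℕ-square v) ⟩
    fromℕ u * fromℕ v              ≈⟨ fromℕ-* u v ⟨
    fromℕ (u *ℕ v)                 ∎

  √ℕ-+-square : ∀ u v →
    (√ℕ u + √ℕ v) * (√ℕ u + √ℕ v) ≈ fromℕ (u +ℕ v) + (√ℕ u * √ℕ v + √ℕ u * √ℕ v)
  √ℕ-+-square u v = begin-equality
    (√ℕ u + √ℕ v) * (√ℕ u + √ℕ v)
      ≈⟨ solve 2 (λ x y → (x :+ y) :* (x :+ y) := (x :* x :+ y :* y) :+ (x :* y :+ x :* y)) refl (√ℕ u) (√ℕ v) ⟩
    (√ℕ u * √ℕ u + √ℕ v * √ℕ v) + (√ℕ u * √ℕ v + √ℕ u * √ℕ v)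
      ≈⟨ +-congʳ (trans (+-cong (√ℕ-square u) (√ℕ-square v)) (sym (fromℕ-+ u v))) ⟩
    fromℕ (u +ℕ v) + (√ℕ u * √ℕ v + √ℕ u * √ℕ v)
      ∎

  module _ {j m a c : ℕ} (j+m≤a+c : j +ℕ m ≤ℕ suc a +ℕ suc c) (m≤a : m ≤ℕ suc a) (m≤c : m ≤ℕ suc c) where

    private
      P Q : Carrier
      P = √ℕ j * √ℕ m
      Q = √ℕ (suc a) * √ℕ (suc c)

      P≤Q : P ≤ Q
      P≤Q = square≈fromℕ-mono (*-nonneg (√ℕ-nonNeg j) (√ℕ-nonNeg m)) (*-nonneg (√ℕ-nonNeg (suc a)) (√ℕ-nonNeg (suc c)))
        (√ℕ-*-square j m) (√ℕ-*-square (suc a) (suc c)) (j+m≤a+c⇒j*m≤a*c j+m≤a+c m≤a m≤c)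

      fromℕ-≤ : fromℕ (j +ℕ m) ≤ fromℕ (suc a +ℕ suc c)
      fromℕ-≤ = fromℕ-mono-≤ j+m≤a+c

    √ℕ-+-≤-suc : √ℕ j + √ℕ m ≤ √ℕ (suc a) + √ℕ (suc c)
    √ℕ-+-≤-suc = square-≤⇒≤ (+-nonNeg (√ℕ-nonNeg j) (√ℕ-nonNeg m))
      (+-nonNeg (√ℕ-nonNeg (suc a)) (√ℕ-nonNeg (suc c)))
      (nonNeg-+-≉0 (√ℕ-nonNeg (suc a)) (√ℕ-nonNeg (suc c)) (√ℕ-suc≉0 a)) (begin
        (√ℕ j + √ℕ m) * (√ℕ j + √ℕ m)                  ≈⟨ √ℕ-+-square j m ⟩
        fromℕ (j +ℕ m) + (P + P)                        ≤⟨ +-mono-≤ fromℕ-≤ (+-mono-≤ P≤Q P≤Q) ⟩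
        fromℕ (suc a +ℕ suc c) + (Q + Q)                ≈⟨ √ℕ-+-square (suc a) (suc c) ⟨
        (√ℕ (suc a) + √ℕ (suc c)) * (√ℕ (suc a) + √ℕ (suc c)) ∎)

    √ℕ-+-≈⇒-suc : √ℕ (suc a) + √ℕ (suc c) ≈ √ℕ j + √ℕ m → m ≡.≡ suc a ⊎ m ≡.≡ suc c
    √ℕ-+-≈⇒-suc e = j+m≡a+c∧j*m≡a*c⇒m≡a∨m≡c j+m≡a+c jm≡ac m≤a m≤c
      where
      squares≈ : fromℕ (j +ℕ m) + (P + P) ≈ fromℕ (suc a +ℕ suc c) + (Q + Q)
      squares≈ = begin-equality
        fromℕ (j +ℕ m) + (P + P)                               ≈⟨ √ℕ-+-square j m ⟨
        (√ℕ j + √ℕ m) * (√ℕ j + √ℕ m)                          ≈⟨ *-cong e e ⟨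
        (√ℕ (suc a) + √ℕ (suc c)) * (√ℕ (suc a) + √ℕ (suc c))  ≈⟨ √ℕ-+-square (suc a) (suc c) ⟩
        fromℕ (suc a +ℕ suc c) + (Q + Q)                       ∎
      split : fromℕ (j +ℕ m) ≈ fromℕ (suc a +ℕ suc c) × P + P ≈ Q + Q
      split = +-≈-split fromℕ-≤ (+-mono-≤ P≤Q P≤Q) squares≈
      j+m≡a+c : j +ℕ m ≡.≡ suc a +ℕ suc c
      j+m≡a+c = fromℕ-injective _ _ (proj₁ split)
      P≈Q : P ≈ Q
      P≈Q = proj₁ (+-≈-split P≤Q P≤Q (proj₂ split))
      jm≡ac : j *ℕ m ≡.≡ suc a *ℕ suc c
      jm≡ac = fromℕ-injective _ _ (begin-equality
        fromℕ (j *ℕ m)           ≈⟨ √ℕ-*-square j m ⟨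
        P * P                    ≈⟨ *-cong P≈Q P≈Q ⟩
        Q * Q                    ≈⟨ √ℕ-*-square (suc a) (suc c) ⟩
        fromℕ (suc a *ℕ suc c)   ∎)

  -- square-≤⇒≤ needs a nonzero right-hand side, so a = 0 and c = 0 are treated directly.
  √ℕ-+-≤ : ∀ {j m a c} → j +ℕ m ≤ℕ a +ℕ c → m ≤ℕ a → m ≤ℕ c → √ℕ j + √ℕ m ≤ √ℕ a + √ℕ c
  √ℕ-+-≤ {j} {a = zero} {c} j+m≤c m≤0 _ with ≡.refl ← ℕ.n≤0⇒n≡0 m≤0 = begin
    √ℕ j + √ℕ 0  ≤⟨ +-monoˡ-≤ (√ℕ 0) (√ℕ-mono-≤ (≡.subst (_≤ℕ c) (ℕ.+-identityʳ j) j+m≤c)) ⟩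
    √ℕ c + √ℕ 0  ≈⟨ +-comm (√ℕ c) (√ℕ 0) ⟩
    √ℕ 0 + √ℕ c  ∎
  √ℕ-+-≤ {j} {a = suc a} {zero} j+m≤a _ m≤0 with ≡.refl ← ℕ.n≤0⇒n≡0 m≤0 =
    +-monoˡ-≤ (√ℕ 0) (√ℕ-mono-≤ (≡.subst₂ _≤ℕ_ (ℕ.+-identityʳ j) (ℕ.+-identityʳ (suc a)) j+m≤a))
  √ℕ-+-≤ {a = suc a} {suc c} = √ℕ-+-≤-suc

  √ℕ-+-≈⇒≡∨≡ : ∀ {j m a c} → j +ℕ m ≤ℕ a +ℕ c → m ≤ℕ a → m ≤ℕ c →
    √ℕ a + √ℕ c ≈ √ℕ j + √ℕ m → m ≡.≡ a ⊎ m ≡.≡ c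
  √ℕ-+-≈⇒≡∨≡ {a = zero}          _ m≤0 _   _ = inj₁ (ℕ.n≤0⇒n≡0 m≤0)
  √ℕ-+-≈⇒≡∨≡ {a = suc a} {zero}  _ _   m≤0 _ = inj₂ (ℕ.n≤0⇒n≡0 m≤0)
  √ℕ-+-≈⇒≡∨≡ {a = suc a} {suc c} j+m≤a+c m≤a m≤c = √ℕ-+-≈⇒-suc j+m≤a+c m≤a m≤c


module _ {c ℓ} (F : OrderedFieldWithSqrt c ℓ) {n : ℕ} where

  open SetPairSizes

  open OrderedFieldWithSqrt F using (_≈_; _+_; refl; +-comm)
  open OrderedFieldProperties F using (_≤_; √ℕ; √ℕ-+-≤; √ℕ-+-≈⇒≡∨≡)

  √ℕ-submodular : ∀ (p q : P₂ n) → √ℕ (joinSize p q) + √ℕ (meetSize p q) ≤ √ℕ (size p) + √ℕ (size q)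
  √ℕ-submodular p q = √ℕ-+-≤ {joinSize p q} {meetSize p q} {size p} {size q}
    (joinSize+meetSize≤size+size p q) (meetSize≤sizeˡ p q) (meetSize≤sizeʳ p q)

  √ℕ-modular⇒comparable : ∀ (p q : P₂ n) →
    √ℕ (size p) + √ℕ (size q) ≈ √ℕ (joinSize p q) + √ℕ (meetSize p q) → p ⊑ q ⊎ q ⊑ p
  √ℕ-modular⇒comparable p q e = ⊎-map (meetSize≡sizeˡ⇒⊑ p q) (meetSize≡sizeʳ⇒⊒ p q)
    (√ℕ-+-≈⇒≡∨≡ {joinSize p q} {meetSize p q} {size p} {size q}
      (joinSize+meetSize≤size+size p q) (meetSize≤sizeˡ p q) (meetSize≤sizeʳ p q) e)

  comparable⇒√ℕ-modular : ∀ (p q : P₂ n) → p ⊑ q ⊎ q ⊑ p →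
    √ℕ (size p) + √ℕ (size q) ≈ √ℕ (joinSize p q) + √ℕ (meetSize p q)
  comparable⇒√ℕ-modular p q (inj₁ p⊑q)
    rewrite ⊑⇒joinSize≡size p q p⊑q | ⊑⇒meetSize≡size p q p⊑q = +-comm _ _
  comparable⇒√ℕ-modular p q (inj₂ q⊑p)
    rewrite joinSize-comm p q | meetSize-comm p q
          | ⊑⇒joinSize≡size q p q⊑p | ⊑⇒meetSize≡size q p q⊑p = refl

mainTheorem16 : ∀ {c ℓ : Level} (F : OrderedFieldWithSqrt c ℓ) (n : ℕ) →
    StrictlySubmodular F n (gSqrt F n)
mainTheorem16 F n = (λ _ → OrderedFieldWithSqrt.sqrt-nonneg F _) , λ p q →
  √ℕ-submodular F p q , mk⇔ (√ℕ-modular⇒comparable F p q) (comparable⇒√ℕ-modular F p q)
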